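{- Let $(b,c,d)\in\bar S$. Then there is no $(b_0,c_0,d_0)\in\bar S$ with $\bar M_B(b_0,c_0,d_0)=(b,c,d)$ if and only if one of the following holds: (i) $b,c,d$ are neither all even nor all odd; (ii) $b,c,d$ are all even, but $c\not\equiv 0\pmod 4$ or $d\not\equiv 0\pmod 8$; (iii) $b,c,d$ are all odd, but $-2b+c\not\equiv 1\pmod 4$ or $b-c+d\not\equiv 1\pmod 8$.
   Context: Let $\bar S$ be the set of all $(b,c,d)\in\mathbb Z^3$ with $b^2-3c\le 0$, $d<0$, and $1+b+c+d>0$. For such a triple, $x^3+bx^2+cx+d$ has a unique real root $\alpha\in(0,1)$, which is irrational, so $1+2b+4c+8d\neq 0$; moreover $\alpha\in(0,1/2)$ iff $1+2b+4c+8d>0$. Define $\bar M_B:\bar S\to\bar S$ (the map corresponding to the Bernoulli map $x\mapsto 2x \bmod 1$ on the roots) by: if $1+2b+4c+8d>0$, then $\bar M_B(b,c,d)=(2b,\,4c,\,8d)$; if $1+2b+4c+8d<0$, then $\bar M_B(b,c,d)=(2b+3,\,4b+4c+3,\,2b+4c+8d+1)$. (The image is the coefficient triple of the minimal polynomial of $2\alpha \bmod 1$ and lies in $\bar S$.) -}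

module Defs where

open import Data.Integer using (ℤ; +_; _+_; _-_; _*_; -_; _≤_; _<_; _<?_)
open import Data.Integer.Divisibility using (_∣_)
open import Data.Product using (_×_; _,_)
open import Data.Sum using (_⊎_)
open import Relation.Nullary using (¬_; yes; no)

Triple : Set
Triple = ℤ × ℤ × ℤ

S̄ : Triple → Set
S̄ (b , c , d) = (b * b - + 3 * c ≤ + 0) × (d < + 0) × (+ 0 < + 1 + b + c + d)

-- 1 + 2b + 4c + 8d (sign decides whether α ∈ (0,1/2))
disc : Triple → ℤ
disc (b , c , d) = + 1 + + 2 * b + + 4 * c + + 8 * d

-- M̄_B.  On S̄, disc ≠ 0, so the branch "not (0 < disc)" is exactly disc < 0.
M̄B : Triple → Triple
M̄B (b , c , d) with + 0 <? disc (b , c , d)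
... | yes _ = (+ 2 * b , + 4 * c , + 8 * d)
... | no  _ = (+ 2 * b + + 3 , + 4 * b + + 4 * c + + 3 , + 2 * b + + 4 * c + + 8 * d + + 1)

infix 4 _≡_[mod_]
_≡_[mod_] : ℤ → ℤ → ℤ → Set
x ≡ y [mod m ] = m ∣ (x - y)

Even : ℤ → Set
Even x = + 2 ∣ x

Odd : ℤ → Set
Odd x = ¬ (+ 2 ∣ x)

AllEven : Triple → Set
AllEven (b , c , d) = Even b × Even c × Even d

AllOdd : Triple → Set
AllOdd (b , c , d) = Odd b × Odd c × Odd d

Cond : Triple → Set
Cond (b , c , d) =
  ((¬ AllEven (b , c , d)) × (¬ AllOdd (b , c , d)))
  ⊎ (AllEven (b , c , d) × (¬ (c ≡ + 0 [mod + 4 ]) ⊎ ¬ (d ≡ + 0 [mod + 8 ])))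
  ⊎ (AllOdd (b , c , d) × (¬ ((- (+ 2 * b)) + c ≡ + 1 [mod + 4 ]) ⊎ ¬ (b - c + d ≡ + 1 [mod + 8 ])))

module Submission where

-- M̄B has two affine branches: `double` (the triple of 8·p(x/2), used when
-- α < 1/2) and `doubleShift` (the triple of 8·p((x+1)/2), used when α > 1/2).
--
-- The image of `double` is exactly the set of triples with
--    the "even pattern" (all even, 4 ∣ c, 8 ∣ d), and the image of
--    `doubleShift` is exactly the set with the "odd pattern" (all odd,
--    -2b + c ≡ 1 mod 4, b - c + d ≡ 1 mod 8).  Every triple satisfies one
--    pattern or the condition Cond, and never both.
--  * Inequalities.  If b² ≤ 3c then p(x) = x³ + bx² + cx + d is strictly
--    increasing on ℤ.  Hence the conditions defining S̄ pull back along both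
--    branches, and the sign of disc on the preimage selects the right branch.

open import Defs
open import Data.Product using (Σ; _×_; _,_)
open import Relation.Nullary using (¬_)
open import Relation.Binary.PropositionalEquality using (_≡_)
open import Function.Bundles using (_⇔_)

open import Data.Empty using (⊥-elim)
open import Data.Sum using (_⊎_; inj₁; inj₂; [_,_]′)
open import Data.List using ([]; _∷_)
open import Function using (id)
open import Function.Bundles using (mk⇔)
open import Relation.Nullary using (Dec; yes; no; ¬?; _×-dec_)
open import Relation.Binary.PropositionalEquality
  using (refl; sym; trans; cong; cong₂; subst; module ≡-Reasoning)

import Data.Nat as ℕ
import Data.Nat.Divisibility as ℕ
import Data.Nat.Properties as ℕ
open import Data.Integer
  using (ℤ; +_; -[1+_]; _+_; _-_; _*_; -_; ∣_∣; _≤_; _<_; +≤+; +<+;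
         _<?_; Positive; NonNegative; nonNegative)
open import Data.Integer.Properties
  using (pos-*; *-zeroʳ; *-comm; +-comm; +-identityˡ; +-identityʳ;
         <⇒≤; positive⁻¹; neg-mono-≤; +-mono-<; +-mono-≤-<; +-mono-<-≤;
         +-monoʳ-<; *-monoˡ-≤-nonNeg; *-cancelˡ-<-nonNeg; *-cancelˡ-≤-pos;
         <-asym; module ≤-Reasoning)
open import Data.Integer.Divisibility using (_∣_)
import Data.Integer.Divisibility.Signed as Signed
open import Data.Integer.DivMod using (_/_; _%_; n%d<d; a≡a%n+[a/n]*n)
open import Data.Integer.Tactic.RingSolver using (solve)

square-nonneg : ∀ x → + 0 ≤ x * x
square-nonneg (+ n)    = subst (+ 0 ≤_) (pos-* n n) (+≤+ ℕ.z≤n)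
square-nonneg -[1+ n ] = +≤+ ℕ.z≤n

module _ (k : ℤ) {{k>0 : Positive k}} where

  private instance
    k≥0 : NonNegative k
    k≥0 = nonNegative (<⇒≤ (positive⁻¹ k))

  cancel-pos : ∀ {x} → + 0 < k * x → + 0 < x
  cancel-pos {x} 0<kx = *-cancelˡ-<-nonNeg k (subst (_< k * x) (sym (*-zeroʳ k)) 0<kx)

  cancel-neg : ∀ {x} → k * x < + 0 → x < + 0
  cancel-neg {x} kx<0 = *-cancelˡ-<-nonNeg k (subst (k * x <_) (sym (*-zeroʳ k)) kx<0)

  cancel-nonpos : ∀ {x} → k * x ≤ + 0 → x ≤ + 0
  cancel-nonpos {x} kx≤0 = *-cancelˡ-≤-pos x (+ 0) k (subst (k * x ≤_) (sym (*-zeroʳ k)) kx≤0)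

-- If b² ≤ 3c, the forward difference p(x+1) - p(x) = 3x² + 3x + 1 + b(2x+1) + c
-- of p(x) = x³ + bx² + cx + d is positive at every integer x, because
--   12 (p(x+1) - p(x)) = (2b + 6x + 3)² + 3 + 4 (3c - b²).
forward-difference-pos : ∀ b c → b * b - + 3 * c ≤ + 0 → ∀ x →
  + 0 < + 3 * x * x + + 3 * x + + 1 + b * (+ 2 * x + + 1) + c
forward-difference-pos b c b²≤3c x =
  cancel-pos (+ 12) (subst (+ 0 <_) twelve-times (+-mono-≤-< (square-nonneg (+ 2 * b + + 6 * x + + 3)) margin))
  where
  margin : + 0 < + 3 + + 4 * - (b * b - + 3 * c)
  margin = +-mono-<-≤ (+<+ (ℕ.s≤s ℕ.z≤n)) (*-monoˡ-≤-nonNeg (+ 4) (neg-mono-≤ b²≤3c))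

  twelve-times : (+ 2 * b + + 6 * x + + 3) * (+ 2 * b + + 6 * x + + 3) + (+ 3 + + 4 * - (b * b - + 3 * c))
               ≡ + 12 * (+ 3 * x * x + + 3 * x + + 1 + b * (+ 2 * x + + 1) + c)
  twelve-times = solve (b ∷ c ∷ x ∷ [])

-- Coefficients of 8·p(x/2): the branch taken when α ∈ (0,1/2).
double : Triple → Triple
double (b , c , d) = (+ 2 * b , + 4 * c , + 8 * d)

-- Coefficients of 8·p((x+1)/2): the branch taken when α ∈ (1/2,1).
doubleShift : Triple → Triple
doubleShift (b , c , d) =
  (+ 2 * b + + 3 , + 4 * b + + 4 * c + + 3 , + 2 * b + + 4 * c + + 8 * d + + 1)

M̄B-double : ∀ t → + 0 < disc t → M̄B t ≡ double t
M̄B-double (b , c , d) disc>0 with + 0 <? disc (b , c , d)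
... | yes _     = refl
... | no disc≯0 = ⊥-elim (disc≯0 disc>0)

M̄B-doubleShift : ∀ t → disc t < + 0 → M̄B t ≡ doubleShift t
M̄B-doubleShift (b , c , d) disc<0 with + 0 <? disc (b , c , d)
... | yes disc>0 = ⊥-elim (<-asym disc<0 disc>0)
... | no _       = refl

-- If double t ∈ S̄ then t ∈ S̄ and disc t > 0.  Write p_t for the cubic of
-- t and p for that of double t.  The only condition not obtained by
-- rescaling is p_t(1) > 0: 8·p_t(1) = p(2) = p(1) + (p(2) - p(1)), and
-- both summands are positive.
double-reflects-S̄ : ∀ t → S̄ (double t) → S̄ t × + 0 < disc t
double-reflects-S̄ (b , c , d) (b²≤3c , d<0 , disc>0) =
  (cancel-nonpos (+ 4) (subst (_≤ + 0) quadratic b²≤3c) ,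
   cancel-neg (+ 8) d<0 ,
   cancel-pos (+ 8) (subst (+ 0 <_) value-at-2
     (+-mono-< disc>0 (forward-difference-pos (+ 2 * b) (+ 4 * c) b²≤3c (+ 1))))) ,
  disc>0
  where
  quadratic : (+ 2 * b) * (+ 2 * b) - + 3 * (+ 4 * c) ≡ + 4 * (b * b - + 3 * c)
  quadratic = solve (b ∷ c ∷ [])

  value-at-2 : (+ 1 + + 2 * b + + 4 * c + + 8 * d) + (+ 7 + (+ 2 * b) * + 3 + + 4 * c)
             ≡ + 8 * (+ 1 + b + c + d)
  value-at-2 = solve (b ∷ c ∷ d ∷ [])

-- If doubleShift t ∈ S̄ then t ∈ S̄ and disc t < 0.  With p the cubic of
-- doubleShift t, the only condition not obtained by rescaling is d < 0:
-- 8d = p(-1) = p(0) - (p(0) - p(-1)) < p(0) < 0.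
doubleShift-reflects-S̄ : ∀ t → S̄ (doubleShift t) → S̄ t × disc t < + 0
doubleShift-reflects-S̄ (b , c , d) (b²≤3c , p0<0 , p1>0) =
  (cancel-nonpos (+ 4) (subst (_≤ + 0) quadratic b²≤3c) ,
   cancel-neg (+ 8) value-at-minus-1 ,
   cancel-pos (+ 8) (subst (+ 0 <_) value-at-1 p1>0)) ,
  subst (_< + 0) constant-term p0<0
  where
  open ≤-Reasoning

  quadratic : (+ 2 * b + + 3) * (+ 2 * b + + 3) - + 3 * (+ 4 * b + + 4 * c + + 3)
            ≡ + 4 * (b * b - + 3 * c)
  quadratic = solve (b ∷ c ∷ [])

  value-at-minus-1 : + 8 * d < + 0
  value-at-minus-1 = begin-strict
    + 8 * d
      ≡⟨ solve (d ∷ []) ⟨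
    + 8 * d + + 0
      <⟨ +-monoʳ-< (+ 8 * d) (forward-difference-pos (+ 2 * b + + 3) (+ 4 * b + + 4 * c + + 3) b²≤3c (- + 1)) ⟩
    + 8 * d + (+ 1 + (+ 2 * b + + 3) * - + 1 + (+ 4 * b + + 4 * c + + 3))
      ≡⟨ solve (b ∷ c ∷ d ∷ []) ⟩
    + 2 * b + + 4 * c + + 8 * d + + 1
      <⟨ p0<0 ⟩
    + 0 ∎

  value-at-1 : + 1 + (+ 2 * b + + 3) + (+ 4 * b + + 4 * c + + 3) + (+ 2 * b + + 4 * c + + 8 * d + + 1)
             ≡ + 8 * (+ 1 + b + c + d)
  value-at-1 = solve (b ∷ c ∷ d ∷ [])

  constant-term : + 2 * b + + 4 * c + + 8 * d + + 1 ≡ + 1 + + 2 * b + + 4 * c + + 8 * d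
  constant-term = solve (b ∷ c ∷ d ∷ [])

infix 4 _∣?_
_∣?_ : ∀ k x → Dec (k ∣ x)
k ∣? x = ∣ k ∣ ℕ.∣? ∣ x ∣

multiple-∣ : ∀ k x q → x ≡ q * k → k ∣ x
multiple-∣ k x q x≡qk = Signed.∣⇒∣ᵤ (Signed.divides q x≡qk)

∣-quotient : ∀ k x → k ∣ x → Σ ℤ (λ q → x ≡ q * k)
∣-quotient k x k∣x with Signed.∣ᵤ⇒∣ k∣x
... | Signed.divides q x≡qk = q , x≡qk

odd-form : ∀ x q → x ≡ q * + 2 + + 1 → Odd x
odd-form x q x≡2q+1 2∣x = ℕ.1+n≰n (ℕ.∣⇒≤ (Signed.∣⇒∣ᵤ 2∣1))
  where
  2∣1 : + 2 Signed.∣ + 1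
  2∣1 = Signed.∣m+n∣m⇒∣n (subst (+ 2 Signed.∣_) x≡2q+1 (Signed.∣ᵤ⇒∣ 2∣x)) (Signed.divides q refl)

odd-quotient : ∀ x → Odd x → Σ ℤ (λ q → x ≡ q * + 2 + + 1)
odd-quotient x odd with x % + 2 | n%d<d x (+ 2) | a≡a%n+[a/n]*n x (+ 2)
... | 0 | _ | x≡2q = ⊥-elim (odd (multiple-∣ (+ 2) x (x / + 2) (trans x≡2q (+-identityˡ _))))
... | 1 | _ | x≡1+2q = x / + 2 , trans x≡1+2q (+-comm (+ 1) ((x / + 2) * + 2))
... | ℕ.suc (ℕ.suc _) | ℕ.s≤s (ℕ.s≤s ()) | _

-- The congruence conditions satisfied by the images of the two branches;
-- Cond says precisely that neither holds.
EvenPattern : Triple → Set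
EvenPattern (b , c , d) = AllEven (b , c , d) × c ≡ + 0 [mod + 4 ] × d ≡ + 0 [mod + 8 ]

OddPattern : Triple → Set
OddPattern (b , c , d) =
  AllOdd (b , c , d) × (- (+ 2 * b)) + c ≡ + 1 [mod + 4 ] × b - c + d ≡ + 1 [mod + 8 ]

Pattern : Triple → Set
Pattern t = EvenPattern t ⊎ OddPattern t

double-pattern : ∀ t → EvenPattern (double t)
double-pattern (b , c , d) =
  (multiple-∣ (+ 2) (+ 2 * b) b (*-comm (+ 2) b) ,
   multiple-∣ (+ 2) (+ 4 * c) (+ 2 * c) (solve (c ∷ [])) ,
   multiple-∣ (+ 2) (+ 8 * d) (+ 4 * d) (solve (d ∷ []))) ,
  multiple-∣ (+ 4) (+ 4 * c - + 0) c (solve (c ∷ [])) ,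
  multiple-∣ (+ 8) (+ 8 * d - + 0) d (solve (d ∷ []))

doubleShift-pattern : ∀ t → OddPattern (doubleShift t)
doubleShift-pattern (b , c , d) =
  (odd-form (+ 2 * b + + 3) (b + + 1) (solve (b ∷ [])) ,
   odd-form (+ 4 * b + + 4 * c + + 3) (+ 2 * b + + 2 * c + + 1) (solve (b ∷ c ∷ [])) ,
   odd-form (+ 2 * b + + 4 * c + + 8 * d + + 1) (b + + 2 * c + + 4 * d) (solve (b ∷ c ∷ d ∷ []))) ,
  multiple-∣ (+ 4) (- (+ 2 * (+ 2 * b + + 3)) + (+ 4 * b + + 4 * c + + 3) - + 1) (c - + 1)
    (solve (b ∷ c ∷ [])) ,
  multiple-∣ (+ 8) ((+ 2 * b + + 3) - (+ 4 * b + + 4 * c + + 3) + (+ 2 * b + + 4 * c + + 8 * d + + 1) - + 1) d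
    (solve (b ∷ c ∷ d ∷ []))

image-pattern : ∀ t₀ → Pattern (M̄B t₀)
image-pattern (b , c , d) with + 0 <? disc (b , c , d)
... | yes _ = inj₁ (double-pattern (b , c , d))
... | no _  = inj₂ (doubleShift-pattern (b , c , d))

even-pattern-preimage : ∀ t → EvenPattern t → Σ Triple (λ t₀ → double t₀ ≡ t)
even-pattern-preimage (b , c , d) ((2∣b , _ , _) , 4∣c , 8∣d)
  with ∣-quotient (+ 2) b 2∣b | ∣-quotient (+ 4) (c - + 0) 4∣c | ∣-quotient (+ 8) (d - + 0) 8∣d
... | β , b≡2β | γ , c≡4γ | δ , d≡8δ =
  (β , γ , δ) ,
  cong₂ _,_ (trans (*-comm (+ 2) β) (sym b≡2β))
    (cong₂ _,_ (trans (*-comm (+ 4) γ) (trans (sym c≡4γ) (+-identityʳ c)))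
               (trans (*-comm (+ 8) δ) (trans (sym d≡8δ) (+-identityʳ d))))

-- The odd pattern characterises the image of `doubleShift`: writing
-- b = 2q + 1, -2b + c - 1 = 4k and b - c + d - 1 = 8m, the preimage is
-- (q - 1, k + 1, m).
odd-pattern-preimage : ∀ t → OddPattern t → Σ Triple (λ t₀ → doubleShift t₀ ≡ t)
odd-pattern-preimage (b , c , d) ((odd-b , _ , _) , 4∣c′ , 8∣d′)
  with odd-quotient b odd-b
     | ∣-quotient (+ 4) ((- (+ 2 * b)) + c - + 1) 4∣c′
     | ∣-quotient (+ 8) (b - c + d - + 1) 8∣d′
... | q , b≡2q+1 | k , c′≡4k | m , d′≡8m =
  (q - + 1 , k + + 1 , m) , cong₂ _,_ first (cong₂ _,_ second third)
  where
  open ≡-Reasoning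

  first : + 2 * (q - + 1) + + 3 ≡ b
  first = trans (solve (q ∷ [])) (sym b≡2q+1)

  4k+2b+1≡c : k * + 4 + + 2 * b + + 1 ≡ c
  4k+2b+1≡c = begin
    k * + 4 + + 2 * b + + 1                ≡⟨ cong (λ v → v + + 2 * b + + 1) c′≡4k ⟨
    (- (+ 2 * b)) + c - + 1 + + 2 * b + + 1  ≡⟨ solve (b ∷ c ∷ []) ⟩
    c                                      ∎

  second : + 4 * (q - + 1) + + 4 * (k + + 1) + + 3 ≡ c
  second = begin
    + 4 * (q - + 1) + + 4 * (k + + 1) + + 3    ≡⟨ solve (q ∷ k ∷ []) ⟩
    k * + 4 + + 2 * (q * + 2 + + 1) + + 1      ≡⟨ cong (λ v → k * + 4 + + 2 * v + + 1) b≡2q+1 ⟨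
    k * + 4 + + 2 * b + + 1                    ≡⟨ 4k+2b+1≡c ⟩
    c                                          ∎

  third : + 2 * (q - + 1) + + 4 * (k + + 1) + + 8 * m + + 1 ≡ d
  third = begin
    + 2 * (q - + 1) + + 4 * (k + + 1) + + 8 * m + + 1
      ≡⟨ solve (q ∷ k ∷ m ∷ []) ⟩
    m * + 8 - (q * + 2 + + 1) + (k * + 4 + + 2 * (q * + 2 + + 1) + + 1) + + 1
      ≡⟨ cong (λ v → m * + 8 - v + (k * + 4 + + 2 * v + + 1) + + 1) b≡2q+1 ⟨
    m * + 8 - b + (k * + 4 + + 2 * b + + 1) + + 1
      ≡⟨ cong₂ (λ u v → u - b + v + + 1) d′≡8m (sym 4k+2b+1≡c) ⟨
    b - c + d - + 1 - b + c + + 1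
      ≡⟨ solve (b ∷ c ∷ d ∷ []) ⟩
    d ∎

even-pattern-or-cond : ∀ t → AllEven t → Pattern t ⊎ Cond t
even-pattern-or-cond (b , c , d) even with + 4 ∣? (c - + 0) | + 8 ∣? (d - + 0)
... | yes 4∣c | yes 8∣d = inj₁ (inj₁ (even , 4∣c , 8∣d))
... | no 4∤c  | _       = inj₂ (inj₂ (inj₁ (even , inj₁ 4∤c)))
... | yes _   | no 8∤d  = inj₂ (inj₂ (inj₁ (even , inj₂ 8∤d)))

odd-pattern-or-cond : ∀ t → AllOdd t → Pattern t ⊎ Cond t
odd-pattern-or-cond (b , c , d) odd
  with + 4 ∣? ((- (+ 2 * b)) + c - + 1) | + 8 ∣? (b - c + d - + 1)
... | yes 4∣c′ | yes 8∣d′ = inj₁ (inj₂ (odd , 4∣c′ , 8∣d′))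
... | no 4∤c′  | _        = inj₂ (inj₂ (inj₂ (odd , inj₁ 4∤c′)))
... | yes _    | no 8∤d′  = inj₂ (inj₂ (inj₂ (odd , inj₂ 8∤d′)))

pattern-or-cond : ∀ t → Pattern t ⊎ Cond t
pattern-or-cond (b , c , d)
  with (+ 2 ∣? b) ×-dec (+ 2 ∣? c) ×-dec (+ 2 ∣? d)
     | ¬? (+ 2 ∣? b) ×-dec ¬? (+ 2 ∣? c) ×-dec ¬? (+ 2 ∣? d)
... | yes even | _       = even-pattern-or-cond (b , c , d) even
... | no _     | yes odd = odd-pattern-or-cond (b , c , d) odd
... | no ¬even | no ¬odd = inj₂ (inj₁ (¬even , ¬odd))

pattern-excludes-cond : ∀ t → Pattern t → ¬ Cond t
pattern-excludes-cond (b , c , d) (inj₁ (even , _)) (inj₁ (¬even , _)) = ¬even even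
pattern-excludes-cond (b , c , d) (inj₁ (_ , 4∣c , _)) (inj₂ (inj₁ (_ , inj₁ 4∤c))) = 4∤c 4∣c
pattern-excludes-cond (b , c , d) (inj₁ (_ , _ , 8∣d)) (inj₂ (inj₁ (_ , inj₂ 8∤d))) = 8∤d 8∣d
pattern-excludes-cond (b , c , d) (inj₁ ((2∣b , _) , _)) (inj₂ (inj₂ ((2∤b , _) , _))) = 2∤b 2∣b
pattern-excludes-cond (b , c , d) (inj₂ (odd , _)) (inj₁ (_ , ¬odd)) = ¬odd odd
pattern-excludes-cond (b , c , d) (inj₂ ((2∤b , _) , _)) (inj₂ (inj₁ ((2∣b , _) , _))) = 2∤b 2∣b
pattern-excludes-cond (b , c , d) (inj₂ (_ , 4∣c′ , _)) (inj₂ (inj₂ (_ , inj₁ 4∤c′))) = 4∤c′ 4∣c′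
pattern-excludes-cond (b , c , d) (inj₂ (_ , _ , 8∣d′)) (inj₂ (inj₂ (_ , inj₂ 8∤d′))) = 8∤d′ 8∣d′

double-preimage : ∀ t₀ → S̄ (double t₀) → S̄ t₀ × M̄B t₀ ≡ double t₀
double-preimage t₀ st =
  let st₀ , disc>0 = double-reflects-S̄ t₀ st in st₀ , M̄B-double t₀ disc>0

doubleShift-preimage : ∀ t₀ → S̄ (doubleShift t₀) → S̄ t₀ × M̄B t₀ ≡ doubleShift t₀
doubleShift-preimage t₀ st =
  let st₀ , disc<0 = doubleShift-reflects-S̄ t₀ st in st₀ , M̄B-doubleShift t₀ disc<0

pattern-preimage : ∀ t → S̄ t → Pattern t → Σ Triple (λ t₀ → S̄ t₀ × M̄B t₀ ≡ t)
pattern-preimage t st (inj₁ even) =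
  let t₀ , double-t₀≡t = even-pattern-preimage t even
  in t₀ , subst (λ u → S̄ t₀ × M̄B t₀ ≡ u) double-t₀≡t
                (double-preimage t₀ (subst S̄ (sym double-t₀≡t) st))
pattern-preimage t st (inj₂ odd) =
  let t₀ , doubleShift-t₀≡t = odd-pattern-preimage t odd
  in t₀ , subst (λ u → S̄ t₀ × M̄B t₀ ≡ u) doubleShift-t₀≡t
                (doubleShift-preimage t₀ (subst S̄ (sym doubleShift-t₀≡t) st))

fact2 : (t : Triple) → S̄ t →
    ((¬ (Σ Triple (λ t₀ → S̄ t₀ × (M̄B t₀ ≡ t)))) ⇔ Cond t)
fact2 t st = mk⇔ no-preimage⇒cond cond⇒no-preimage
  where
  no-preimage⇒cond : ¬ Σ Triple (λ t₀ → S̄ t₀ × M̄B t₀ ≡ t) → Cond t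
  no-preimage⇒cond no-preimage =
    [ (λ has-pattern → ⊥-elim (no-preimage (pattern-preimage t st has-pattern))) , id ]′
      (pattern-or-cond t)

  cond⇒no-preimage : Cond t → ¬ Σ Triple (λ t₀ → S̄ t₀ × M̄B t₀ ≡ t)
  cond⇒no-preimage cond (t₀ , _ , M̄Bt₀≡t) =
    pattern-excludes-cond t (subst Pattern M̄Bt₀≡t (image-pattern t₀)) cond
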